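{- For every positive integer $n$, the number of $n\times n$ magog matrices $A=(a_{ij})$ with $a_{11}=1$ or $a_{12}=1$ is $2^{n-1}$.
   Context: An $n\times n$ magog matrix is an $n\times n$ matrix $A=(a_{ij})$ with entries in $\{0,1,-1\}$ such that all row sums and all column sums equal $1$, $0\le \sum_{i'=1}^{i}a_{i'j}\le 1$ for all $1\le i,j\le n$, $\sum_{j'=1}^{j}a_{ij'}\ge 0$ for all $1\le i,j\le n$, and for all $1\le i\le n-2$, $1\le j\le n-2$, $$\sum_{j'=1}^{j}a_{i+1,j'}+\sum_{i'=1}^{i+1}a_{i',j+1}-\sum_{i'=1}^{i}a_{i'j}\ge 0.$$ -}

module Defs where

open import Data.Nat as ℕ using (ℕ; zero; suc; _∸_)
open import Data.Integer as ℤ using (ℤ; +_; -[1+_]; _+_; _-_; _≤_)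
open import Data.Integer.Properties as ℤP using ()
open import Data.List as List using (List; []; _∷_; filter; length; concatMap; map)
open import Data.List.Relation.Unary.All using (All; all?)
open import Data.Vec as Vec using (Vec; []; _∷_; replicate)
open import Data.Product using (_×_; _,_)
open import Data.Sum using (_⊎_)
open import Relation.Binary.PropositionalEquality using (_≡_)
open import Relation.Nullary using (Dec)
open import Relation.Nullary.Decidable using (_×-dec_; _⊎-dec_)
open import Relation.Unary using (Decidable)

Matrix : ℕ → Set
Matrix n = Vec (Vec ℤ n) n

entryValues : List ℤ
entryValues = + 0 ∷ + 1 ∷ -[1+ 0 ] ∷ []

allVecs : ∀ {A : Set} → List A → (k : ℕ) → List (Vec A k)
allVecs xs zero    = [] ∷ []
allVecs xs (suc k) = concatMap (λ x → map (x ∷_) (allVecs xs k)) xs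

allMatrices : (n : ℕ) → List (Matrix n)
allMatrices n = allVecs (allVecs entryValues n) n

-- 1-based indexing (index 0 or beyond the length returns the default).
getℤ : ∀ {k} → Vec ℤ k → ℕ → ℤ
getℤ []       _             = + 0
getℤ (x ∷ xs) zero          = + 0
getℤ (x ∷ xs) (suc zero)    = x
getℤ (x ∷ xs) (suc (suc i)) = getℤ xs (suc i)

getRow : ∀ {m k} → Vec (Vec ℤ k) m → ℕ → Vec ℤ k
getRow {k = k} []       _             = replicate k (+ 0)
getRow {k = k} (r ∷ rs) zero          = replicate k (+ 0)
getRow         (r ∷ rs) (suc zero)    = r
getRow         (r ∷ rs) (suc (suc i)) = getRow rs (suc i)

ent : ∀ {n} → Matrix n → ℕ → ℕ → ℤ
ent A i j = getℤ (getRow A i) j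

Σ[1,_] : ℕ → (ℕ → ℤ) → ℤ
Σ[1, zero  ] f = + 0
Σ[1, suc m ] f = Σ[1, m ] f + f (suc m)

colPartial : ∀ {n} → Matrix n → ℕ → ℕ → ℤ
colPartial A i j = Σ[1, i ] (λ i' → ent A i' j)

rowPartial : ∀ {n} → Matrix n → ℕ → ℕ → ℤ
rowPartial A i j = Σ[1, j ] (λ j' → ent A i j')

range1 : ℕ → List ℕ
range1 zero    = []
range1 (suc m) = range1 m List.++ (suc m ∷ [])

-- Magog matrix conditions (entries in {0,1,-1} are guaranteed by allMatrices).
IsMagog : ∀ {n} → Matrix n → Set
IsMagog {n} A =
  All (λ i → rowPartial A i n ≡ + 1) (range1 n) ×
  All (λ j → colPartial A n j ≡ + 1) (range1 n) ×
  All (λ i → All (λ j → (+ 0 ≤ colPartial A i j) × (colPartial A i j ≤ + 1)) (range1 n)) (range1 n) ×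
  All (λ i → All (λ j → + 0 ≤ rowPartial A i j) (range1 n)) (range1 n) ×
  All (λ i → All (λ j →
        + 0 ≤ (rowPartial A (suc i) j + colPartial A (suc i) (suc j)) - colPartial A i j)
      (range1 (n ∸ 2))) (range1 (n ∸ 2))

isMagog? : ∀ {n} → Decidable (IsMagog {n})
isMagog? {n} A =
  all? (λ i → rowPartial A i n ℤ.≟ + 1) (range1 n) ×-dec
  all? (λ j → colPartial A n j ℤ.≟ + 1) (range1 n) ×-dec
  all? (λ i → all? (λ j → (+ 0 ℤ.≤? colPartial A i j) ×-dec (colPartial A i j ℤ.≤? + 1)) (range1 n)) (range1 n) ×-dec
  all? (λ i → all? (λ j → + 0 ℤ.≤? rowPartial A i j) (range1 n)) (range1 n) ×-dec
  all? (λ i → all? (λ j →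
        + 0 ℤ.≤? ((rowPartial A (suc i) j + colPartial A (suc i) (suc j)) - colPartial A i j))
      (range1 (n ∸ 2))) (range1 (n ∸ 2))

Corner : ∀ {n} → Matrix n → Set
Corner A = (ent A 1 1 ≡ + 1) ⊎ (ent A 1 2 ≡ + 1)

corner? : ∀ {n} → Decidable (Corner {n})
corner? A = (ent A 1 1 ℤ.≟ + 1) ⊎-dec (ent A 1 2 ℤ.≟ + 1)

countMagogCorner : ℕ → ℕ
countMagogCorner n =
  length (filter (λ A → isMagog? A ×-dec corner? A) (allMatrices n))

-- Let c i j = a₁ⱼ + ⋯ + aᵢⱼ be the column partial sums of a magog matrix A. Every c i j is 0 or 1, row i of c
-- sums to i, row n is all ones, and the remaining magog conditions compare consecutive rows of c. If a₁₁ = 1 or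
-- a₁₂ = 1, induction on i shows that for 1 ≤ i < n row i of c is the indicator of [1, i+1] with a single hole
-- at yᵢ, and that yᵢ < yᵢ₊₁ whenever yᵢ ≥ 2. Conversely, every such hole sequence y₁ … yₙ₋₁ (1 ≤ yᵢ ≤ i+1)
-- yields, by differencing consecutive rows, a magog matrix with the corner property, and the two constructions
-- are inverse to each other. A hole sequence of length m+1 either ends with its largest possible value m+2, or
-- starts with 1 (once yᵢ ≥ 2 the sequence rises by at least one per step) and y₂ … yₘ₊₁ is a hole sequence of
-- length m. Hence there are 2^m hole sequences of length m, and 2^(n-1) such magog matrices.

module Submission where

open import Data.Nat
open import Data.Nat.Properties
open import Data.Integer as ℤ using (ℤ; +_; ∣_∣)
open import Data.Integer.Properties as ℤ using (+-injective; drop‿+≤+; 0≤i-j⇒j≤i; i≤j⇒0≤j-i; 0≤i⇒+∣i∣≡i)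
open import Data.Integer.Tactic.RingSolver using (solve-∀)
open import Data.Product using (_×_; _,_; proj₁; proj₂; ∃-syntax)
open import Data.Sum as Sum using (_⊎_; inj₁; inj₂)
open import Data.Empty using (⊥-elim)
open import Data.List using (List; []; _∷_; map; _++_; length; filter; concatMap; cartesianProductWith)
open import Data.List.Properties using (length-map; length-++)
open import Data.List.Relation.Unary.All as All using (All; []; _∷_)
import Data.List.Relation.Unary.All.Properties as All
open import Data.List.Relation.Unary.AllPairs as AllPairs using (AllPairs; []; _∷_)
import Data.List.Relation.Unary.AllPairs.Properties as AllPairs
open import Data.List.Relation.Unary.Any using (here; there)
open import Data.List.Relation.Unary.Unique.Propositional using (Unique)
import Data.List.Relation.Unary.Unique.Propositional.Properties as Unique
open import Data.List.Membership.Propositional using (_∈_)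
open import Data.List.Membership.Propositional.Properties
  using (∈-map⁺; ∈-map⁻; ∈-++⁺ˡ; ∈-++⁺ʳ; ∈-filter⁺; ∈-filter⁻; ∈-cartesianProductWith⁺)
open import Data.List.Membership.Propositional.Properties.WithK using (unique∧set⇒bag)
open import Data.List.Relation.Binary.BagAndSetEquality using (∼bag⇒↭)
open import Data.List.Relation.Binary.Permutation.Propositional.Properties using (↭-length)
open import Data.Vec using (Vec; []; _∷_)
open import Data.Vec.Properties using (∷-injective)
open import Function.Bundles using (mk⇔)
open import Relation.Nullary using (¬_; Dec; yes; no)
open import Relation.Nullary.Decidable using (_×-dec_)
open import Relation.Binary.Definitions using (tri<; tri≈; tri>)
open import Relation.Binary.PropositionalEquality

open import Defs

-- Prefix sums of 0/1 rows

All[1,_] : ℕ → (ℕ → Set) → Set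
All[1, m ] P = ∀ k → 1 ≤ k → k ≤ m → P k

All[1,]-weaken : ∀ {m n P} → m ≤ n → All[1, n ] P → All[1, m ] P
All[1,]-weaken m≤n h k 1≤k k≤m = h k 1≤k (≤-trans k≤m m≤n)

All[1,]-init : ∀ {m P} → All[1, suc m ] P → All[1, m ] P
All[1,]-init = All[1,]-weaken (n≤1+n _)

All[1,]-last : ∀ {m P} → All[1, suc m ] P → P (suc m)
All[1,]-last h = h _ (s≤s z≤n) ≤-refl

_≗[_]_ : (ℕ → ℕ) → ℕ → (ℕ → ℕ) → Set
f ≗[ m ] g = All[1, m ] (λ k → f k ≡ g k)

psum : ℕ → (ℕ → ℕ) → ℕ
psum zero    f = 0
psum (suc m) f = psum m f + f (suc m)

psum-cong : ∀ m {f g} → f ≗[ m ] g → psum m f ≡ psum m g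
psum-cong zero    f≗g = refl
psum-cong (suc m) f≗g = cong₂ _+_ (psum-cong m (All[1,]-init f≗g)) (All[1,]-last f≗g)

psum-mono : ∀ f {i j} → i ≤ j → psum i f ≤ psum j f
psum-mono f {j = zero}  z≤n = ≤-refl
psum-mono f {j = suc j} i≤1+j with m≤n⇒m<n∨m≡n i≤1+j
... | inj₂ refl      = ≤-refl
... | inj₁ (s≤s i≤j) = ≤-trans (psum-mono f i≤j) (m≤m+n _ _)

psum≤ : ∀ m {f} → All[1, m ] (λ k → f k ≤ 1) → psum m f ≤ m
psum≤ zero    f≤1 = z≤n
psum≤ (suc m) f≤1 = begin
  psum m _ + _  ≤⟨ +-mono-≤ (psum≤ m (All[1,]-init f≤1)) (All[1,]-last f≤1) ⟩
  m + 1         ≡⟨ +-comm m 1 ⟩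
  suc m         ∎
  where open ≤-Reasoning

+-≡-bounds : ∀ {a b m n} → a ≤ m → b ≤ n → a + b ≡ m + n → a ≡ m × b ≡ n
+-≡-bounds {a} {b} {m} {n} a≤m b≤n e = a≡m , +-cancelˡ-≡ a b n (trans e (cong (_+ n) (sym a≡m)))
  where
  a≡m : a ≡ m
  a≡m = ≤-antisym a≤m (+-cancelʳ-≤ n m a (≤-trans (≤-reflexive (sym e)) (+-monoʳ-≤ a b≤n)))

psum≡-split : ∀ m {f} → All[1, suc m ] (λ k → f k ≤ 1) → psum (suc m) f ≡ suc m →
              psum m f ≡ m × f (suc m) ≡ 1
psum≡-split m f≤1 e = +-≡-bounds (psum≤ m (All[1,]-init f≤1)) (All[1,]-last f≤1) (trans e (+-comm 1 m))

psum≡⇒all1 : ∀ m {f} → All[1, m ] (λ k → f k ≤ 1) → psum m f ≡ m → All[1, m ] (λ k → f k ≡ 1)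
psum≡⇒all1 zero    f≤1 e k 1≤k k≤0 = ⊥-elim (<⇒≱ 1≤k k≤0)
psum≡⇒all1 (suc m) f≤1 e k 1≤k k≤1+m with m≤n⇒m<n∨m≡n k≤1+m
... | inj₂ refl      = proj₂ (psum≡-split m f≤1 e)
... | inj₁ (s≤s k≤m) = psum≡⇒all1 m (All[1,]-init f≤1) (proj₁ (psum≡-split m f≤1 e)) k 1≤k k≤m

psum-stable⇒0 : ∀ m n {f} → m ≤ n → psum n f ≡ psum m f → ∀ k → m < k → k ≤ n → f k ≡ 0
psum-stable⇒0 m n {f} m≤n e (suc k) m<k k≤n = n≤0⇒n≡0 (+-cancelˡ-≤ (psum k f) _ _ (begin
  psum k f + f (suc k)  ≤⟨ psum-mono f k≤n ⟩
  psum n f              ≡⟨ e ⟩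
  psum m f              ≤⟨ psum-mono f (≤-pred m<k) ⟩
  psum k f              ≡⟨ +-identityʳ _ ⟨
  psum k f + 0          ∎))
  where open ≤-Reasoning

opaque
  gapRow : ℕ → ℕ → ℕ → ℕ
  gapRow m y j with j ≤? m | j ≟ y
  ... | yes _ | no _ = 1
  ... | _     | _    = 0

  gapRow-in : ∀ {m y j} → j ≤ m → j ≢ y → gapRow m y j ≡ 1
  gapRow-in {m} {y} {j} j≤m j≢y with j ≤? m | j ≟ y
  ... | yes _   | no _     = refl
  ... | _       | yes j≡y  = ⊥-elim (j≢y j≡y)
  ... | no j≰m  | no _     = ⊥-elim (j≰m j≤m)

  gapRow-hole : ∀ m y → gapRow m y y ≡ 0
  gapRow-hole m y with y ≤? m | y ≟ y
  ... | yes _ | no y≢y = ⊥-elim (y≢y refl)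
  ... | yes _ | yes _  = refl
  ... | no _  | _      = refl

  gapRow-out : ∀ {m y j} → m < j → gapRow m y j ≡ 0
  gapRow-out {m} {y} {j} m<j with j ≤? m | j ≟ y
  ... | yes j≤m | no _  = ⊥-elim (<⇒≱ m<j j≤m)
  ... | yes _   | yes _ = refl
  ... | no _    | _     = refl

  gapRow≤1 : ∀ m y j → gapRow m y j ≤ 1
  gapRow≤1 m y j with j ≤? m | j ≟ y
  ... | yes _ | no _  = ≤-refl
  ... | yes _ | yes _ = z≤n
  ... | no _  | _     = z≤n

gapRow-extend : ∀ {m m′ y k} → k ≤ m → m ≤ m′ → gapRow m y k ≡ gapRow m′ y k
gapRow-extend {m} {m′} {y} {k} k≤m m≤m′ with k ≟ y
... | yes refl = trans (gapRow-hole m k) (sym (gapRow-hole m′ k))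
... | no k≢y   = trans (gapRow-in k≤m k≢y) (sym (gapRow-in (≤-trans k≤m m≤m′) k≢y))

HasHole : ℕ → ℕ → (ℕ → ℕ) → ℕ → Set
HasHole n m f y = 1 ≤ y × y ≤ m × All[1, n ] (λ k → f k ≡ gapRow m y k)

psum-pred⇒hole : ∀ m {f} → All[1, m ] (λ k → f k ≤ 1) → suc (psum m f) ≡ m → ∃[ y ] HasHole m m f y
psum-pred⇒hole zero _ ()
psum-pred⇒hole (suc m) {f} f≤1 e with n≤1⇒n≡0∨n≡1 (All[1,]-last f≤1)
... | inj₁ f≡0 = suc m , s≤s z≤n , ≤-refl , agree
  where
  ones : All[1, m ] (λ k → f k ≡ 1)
  ones = psum≡⇒all1 m (All[1,]-init f≤1)
           (trans (sym (+-identityʳ _)) (trans (cong (_+_ (psum m f)) (sym f≡0)) (suc-injective e)))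
  agree : All[1, suc m ] (λ k → f k ≡ gapRow (suc m) (suc m) k)
  agree k 1≤k k≤1+m with m≤n⇒m<n∨m≡n k≤1+m
  ... | inj₂ refl      = trans f≡0 (sym (gapRow-hole _ _))
  ... | inj₁ (s≤s k≤m) = trans (ones k 1≤k k≤m) (sym (gapRow-in k≤1+m (<⇒≢ (s≤s k≤m))))
... | inj₂ f≡1 with psum-pred⇒hole m (All[1,]-init f≤1)
                      (trans (+-comm 1 _) (trans (cong (_+_ (psum m f)) (sym f≡1)) (suc-injective e)))
...   | y , 1≤y , y≤m , agree = y , 1≤y , m≤n⇒m≤1+n y≤m , agree′
  where
  agree′ : All[1, suc m ] (λ k → f k ≡ gapRow (suc m) y k)
  agree′ k 1≤k k≤1+m with m≤n⇒m<n∨m≡n k≤1+m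
  ... | inj₂ refl      = trans f≡1 (sym (gapRow-in ≤-refl (λ k≡y → <⇒≢ (s≤s y≤m) (sym k≡y))))
  ... | inj₁ (s≤s k≤m) = trans (agree k 1≤k k≤m) (gapRow-extend k≤m (n≤1+n m))

psum-pred∧stable⇒hole : ∀ m n {f} → m ≤ n → All[1, n ] (λ k → f k ≤ 1) →
             suc (psum m f) ≡ m → psum n f ≡ psum m f → ∃[ y ] HasHole n m f y
psum-pred∧stable⇒hole m n {f} m≤n f≤1 e₁ e₂ with psum-pred⇒hole m (All[1,]-weaken m≤n f≤1) e₁
... | y , 1≤y , y≤m , agree = y , 1≤y , y≤m , agree′
  where
  agree′ : All[1, n ] (λ k → f k ≡ gapRow m y k)
  agree′ k 1≤k k≤n with k ≤? m
  ... | yes k≤m = agree k 1≤k k≤m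
  ... | no k≰m  = trans (psum-stable⇒0 m n m≤n e₂ k (≰⇒> k≰m) k≤n) (sym (gapRow-out (≰⇒> k≰m)))

module GapRowSums {m y : ℕ} (1≤y : 1 ≤ y) (y≤m : y ≤ m) where

  S : ℕ → ℕ
  S j = psum j (gapRow m y)

  S-below : ∀ j → j < y → S j ≡ j
  S-below zero    _   = refl
  S-below (suc j) j<y = begin
    S j + gapRow m y (suc j)  ≡⟨ cong₂ _+_ (S-below j (<⇒≤ j<y)) (gapRow-in (≤-trans (<⇒≤ j<y) y≤m) (<⇒≢ j<y)) ⟩
    j + 1                     ≡⟨ +-comm j 1 ⟩
    suc j                     ∎
    where open ≡-Reasoning

  S-from : ∀ j → y ≤ j → j ≤ m → suc (S j) ≡ j
  S-from zero    y≤0 _ = ⊥-elim (<⇒≱ 1≤y y≤0)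
  S-from (suc j) y≤j+1 j+1≤m with m≤n⇒m<n∨m≡n y≤j+1
  ... | inj₂ refl = begin
    suc (S j + gapRow m y (suc j))  ≡⟨ cong suc (cong₂ _+_ (S-below j ≤-refl) (gapRow-hole m (suc j))) ⟩
    suc (j + 0)                     ≡⟨ cong suc (+-identityʳ j) ⟩
    suc j                           ∎
    where open ≡-Reasoning
  ... | inj₁ (s≤s y≤j) = begin
    suc (S j + gapRow m y (suc j))  ≡⟨ cong (λ z → suc (S j + z)) (gapRow-in j+1≤m (λ e → <⇒≢ (s≤s y≤j) (sym e))) ⟩
    suc (S j + 1)                   ≡⟨ cong suc (+-comm (S j) 1) ⟩
    suc (suc (S j))                 ≡⟨ cong suc (S-from j y≤j (<⇒≤ j+1≤m)) ⟩
    suc j                           ∎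
    where open ≡-Reasoning

  S-beyond : ∀ j → m ≤ j → suc (S j) ≡ m
  S-beyond zero    m≤0 = ⊥-elim (<⇒≱ (≤-trans 1≤y y≤m) m≤0)
  S-beyond (suc j) m≤j+1 with m≤n⇒m<n∨m≡n m≤j+1
  ... | inj₂ refl      = S-from (suc j) y≤m ≤-refl
  ... | inj₁ (s≤s m≤j) = begin
    suc (S j + gapRow m y (suc j))  ≡⟨ cong (λ z → suc (S j + z)) (gapRow-out (s≤s m≤j)) ⟩
    suc (S j + 0)                   ≡⟨ cong suc (+-identityʳ (S j)) ⟩
    suc (S j)                       ≡⟨ S-beyond j m≤j ⟩
    m                               ∎
    where open ≡-Reasoning

  S<from : ∀ j → y ≤ j → S j < j
  S<from j y≤j with j ≤? m
  ... | yes j≤m = ≤-reflexive (S-from j y≤j j≤m)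
  ... | no j≰m  = ≤-trans (≤-reflexive (S-beyond j (<⇒≤ (≰⇒> j≰m)))) (<⇒≤ (≰⇒> j≰m))

  ≤1+S : ∀ j → j ≤ m → j ≤ suc (S j)
  ≤1+S j j≤m with j <? y
  ... | yes j<y = ≤-trans (n≤1+n j) (≤-reflexive (cong suc (sym (S-below j j<y))))
  ... | no j≮y  = ≤-reflexive (sym (S-from j (≮⇒≥ j≮y) j≤m))

  S<m : ∀ j → S j < m
  S<m j with j ≤? m
  ... | no j≰m  = ≤-reflexive (S-beyond j (<⇒≤ (≰⇒> j≰m)))
  ... | yes j≤m = ≤-trans (s≤s (psum-mono (gapRow m y) j≤m)) (≤-reflexive (S-beyond m ≤-refl))

module ConsecutiveGapRows {m y y′ : ℕ} (1≤y : 1 ≤ y) (y≤m : y ≤ m) (1≤y′ : 1 ≤ y′) (y′≤1+m : y′ ≤ suc m)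
                          (increasing : 2 ≤ y → y < y′) where

  open GapRowSums 1≤y y≤m
  open GapRowSums 1≤y′ y′≤1+m renaming (S to S′; S-below to S′-below; S-beyond to S′-beyond; ≤1+S to ≤1+S′)
    using ()

  y≤y′ : y ≤ y′
  y≤y′ with 2 ≤? y
  ... | yes 2≤y = <⇒≤ (increasing 2≤y)
  ... | no 2≰y  = ≤-trans (≤-pred (≰⇒> 2≰y)) 1≤y′

  S≤S′ : ∀ j → S j ≤ S′ j
  S≤S′ j with j <? y | j ≤? suc m
  ... | yes j<y | _        = ≤-reflexive (trans (S-below j j<y) (sym (S′-below j (<-≤-trans j<y y≤y′))))
  ... | no j≮y  | yes j≤m+1 = ≤-pred (≤-trans (S<from j (≮⇒≥ j≮y)) (≤1+S′ j j≤m+1))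
  ... | no _    | no j≰m+1 = ≤-trans (<⇒≤ (S<m j)) (≤-reflexive (sym (suc-injective (S′-beyond j (<⇒≤ (≰⇒> j≰m+1))))))

  S+gap≤S′ : ∀ j → 1 ≤ j → S j + gapRow m y j ≤ S′ (suc j)
  S+gap≤S′ j 1≤j with <-cmp j y
  ... | tri< j<y _ _ = ≤-reflexive (begin
    S j + gapRow m y j  ≡⟨ cong₂ _+_ (S-below j j<y) (gapRow-in (≤-trans (<⇒≤ j<y) y≤m) (<⇒≢ j<y)) ⟩
    j + 1               ≡⟨ +-comm j 1 ⟩
    suc j               ≡⟨ S′-below (suc j) (<-≤-trans (s≤s j<y) (increasing (≤-trans (s≤s 1≤j) j<y))) ⟨
    S′ (suc j)          ∎)
    where open ≡-Reasoning
  ... | tri≈ _ refl _ = begin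
    S j + gapRow m j j  ≡⟨ cong (_+_ (S j)) (gapRow-hole m j) ⟩
    S j + 0             ≡⟨ +-identityʳ (S j) ⟩
    S j                 <⟨ S<from j ≤-refl ⟩
    j                   ≤⟨ ≤-pred (≤1+S′ (suc j) (s≤s y≤m)) ⟩
    S′ (suc j)          ∎
    where open ≤-Reasoning
  ... | tri> _ _ y<j with suc j ≤? suc m
  ...   | yes j+1≤m+1 = begin
    S j + gapRow m y j  ≤⟨ +-monoʳ-≤ (S j) (gapRow≤1 m y j) ⟩
    S j + 1             ≡⟨ +-comm (S j) 1 ⟩
    suc (S j)           ≤⟨ S<from j (<⇒≤ y<j) ⟩
    j                   ≤⟨ ≤-pred (≤1+S′ (suc j) j+1≤m+1) ⟩
    S′ (suc j)          ∎
    where open ≤-Reasoning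
  ...   | no j+1≰m+1 = begin
    S j + gapRow m y j  ≡⟨ cong (_+_ (S j)) (gapRow-out m<j) ⟩
    S j + 0             ≡⟨ +-identityʳ (S j) ⟩
    S j                 ≤⟨ n≤1+n (S j) ⟩
    suc (S j)           ≡⟨ S-beyond j (<⇒≤ m<j) ⟩
    m                   ≡⟨ suc-injective (S′-beyond (suc j) (<⇒≤ (≰⇒> j+1≰m+1))) ⟨
    S′ (suc j)          ∎
    where
    open ≤-Reasoning
    m<j : m < j
    m<j = ≤-pred (≰⇒> j+1≰m+1)

-- Hole sequences and their staircases

record IsHoleSequence (n : ℕ) (x : ℕ → ℕ) : Set where
  field
    hole≥1 : ∀ i → 1 ≤ i → i < n → 1 ≤ x i
    hole≤  : ∀ i → 1 ≤ i → i < n → x i ≤ suc i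
    hole-< : ∀ i → 1 ≤ i → suc i < n → 2 ≤ x i → x i < x (suc i)

-- The sequence is completed by y₀ = 1 and yᵢ = i+1 for i ≥ n, so that rows 0 and n of the staircase are
-- the zero row and the all-ones row.
opaque
  holes : ℕ → (ℕ → ℕ) → ℕ → ℕ
  holes n x zero    = 1
  holes n x (suc i) with n ≤? suc i
  ... | yes _ = suc (suc i)
  ... | no _  = x (suc i)

  holes-0 : ∀ n x → holes n x 0 ≡ 1
  holes-0 n x = refl

  holes-inner : ∀ n x i → suc i < n → holes n x (suc i) ≡ x (suc i)
  holes-inner n x i i+1<n with n ≤? suc i
  ... | yes n≤i+1 = ⊥-elim (<⇒≱ i+1<n n≤i+1)
  ... | no _      = refl

  holes-outer : ∀ n x i → n ≤ suc i → holes n x (suc i) ≡ suc (suc i)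
  holes-outer n x i n≤i+1 with n ≤? suc i
  ... | yes _     = refl
  ... | no n≰i+1  = ⊥-elim (n≰i+1 n≤i+1)

holes-last : ∀ n x → holes n x n ≡ suc n
holes-last zero    x = holes-0 0 x
holes-last (suc n) x = holes-outer (suc n) x n ≤-refl

module _ {n x} (H : IsHoleSequence n x) where
  open IsHoleSequence H

  holes-bounds : ∀ i → i ≤ n → 1 ≤ holes n x i × holes n x i ≤ suc i
  holes-bounds zero    _ rewrite holes-0 n x = ≤-refl , ≤-refl
  holes-bounds (suc i) _ with n ≤? suc i
  ... | yes n≤i+1 rewrite holes-outer n x i n≤i+1 = s≤s z≤n , ≤-refl
  ... | no n≰i+1  rewrite holes-inner n x i (≰⇒> n≰i+1) =
    hole≥1 (suc i) (s≤s z≤n) (≰⇒> n≰i+1) , hole≤ (suc i) (s≤s z≤n) (≰⇒> n≰i+1)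

  holes-increasing : ∀ i → suc i ≤ n → 2 ≤ holes n x i → holes n x i < holes n x (suc i)
  holes-increasing zero    _ 2≤h rewrite holes-0 n x with 2≤h
  ... | s≤s ()
  holes-increasing (suc i) i+2≤n 2≤h rewrite holes-inner n x i i+2≤n with n ≤? suc (suc i)
  ... | yes n≤i+2 rewrite holes-outer n x (suc i) n≤i+2 = s≤s (hole≤ (suc i) (s≤s z≤n) i+2≤n)
  ... | no n≰i+2  rewrite holes-inner n x (suc i) (≰⇒> n≰i+2) = hole-< (suc i) (s≤s z≤n) (≰⇒> n≰i+2) 2≤h

staircase : ℕ → (ℕ → ℕ) → ℕ → ℕ → ℕ
staircase n x i = gapRow (suc i) (holes n x i)

staircase-first : ∀ n x {j} → 1 ≤ j → staircase n x 0 j ≡ 0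
staircase-first n x {j} 1≤j rewrite holes-0 n x with m≤n⇒m<n∨m≡n 1≤j
... | inj₂ refl = gapRow-hole 1 1
... | inj₁ 1<j  = gapRow-out 1<j

staircase-last : ∀ n x {j} → j ≤ n → staircase n x n j ≡ 1
staircase-last n x {j} j≤n = trans (cong (λ h → gapRow (suc n) h j) (holes-last n x))
                                   (gapRow-in (m≤n⇒m≤1+n j≤n) (<⇒≢ (s≤s j≤n)))

≤∸2⇒2+≤ : ∀ {i n} → 1 ≤ i → i ≤ n ∸ 2 → 2 + i ≤ n
≤∸2⇒2+≤ {n = suc (suc n)} _   i≤n = s≤s (s≤s i≤n)
≤∸2⇒2+≤ {n = 0}           1≤i i≤0 = ⊥-elim (<⇒≱ 1≤i i≤0)
≤∸2⇒2+≤ {n = 1}           1≤i i≤0 = ⊥-elim (<⇒≱ 1≤i i≤0)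

2+≤⇒≤∸2 : ∀ {i n} → 2 + i ≤ n → i ≤ n ∸ 2
2+≤⇒≤∸2 (s≤s (s≤s i≤n)) = i≤n

blockSum : (ℕ → ℕ → ℕ) → ℕ → ℕ → ℕ
blockSum c i j = psum j (c i)

-- c i j stands for the column partial sum a₁ⱼ + ⋯ + aᵢⱼ. The row partial sums of row i+1 are then
-- blockSum c (i+1) j − blockSum c i j, and each field is the corresponding magog condition in these terms.
record IsMagogColumnSums (n : ℕ) (c : ℕ → ℕ → ℕ) : Set where
  field
    entry≤1   : ∀ i j → 1 ≤ i → i ≤ n → 1 ≤ j → j ≤ n → c i j ≤ 1
    rowSum    : ∀ i → suc i ≤ n → blockSum c (suc i) n ≡ suc (blockSum c i n)
    lastRow   : ∀ j → 1 ≤ j → j ≤ n → c n j ≡ 1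
    rowPrefix : ∀ i j → suc i ≤ n → 1 ≤ j → j ≤ n → blockSum c i j ≤ blockSum c (suc i) j
    magog     : ∀ i j → 1 ≤ i → i ≤ n ∸ 2 → 1 ≤ j → j ≤ n ∸ 2 →
                blockSum c i j + c i j ≤ blockSum c (suc i) (suc j)

staircase-magog : ∀ {n x} → IsHoleSequence n x → IsMagogColumnSums n (staircase n x)
staircase-magog {n} {x} H = record
  { entry≤1   = λ i j _ _ _ _ → gapRow≤1 _ _ _
  ; rowSum    = λ i i+1≤n → trans (rowTotal (suc i) i+1≤n) (cong suc (sym (rowTotal i (<⇒≤ i+1≤n))))
  ; lastRow   = λ j _ j≤n → staircase-last n x j≤n
  ; rowPrefix = λ i j i+1≤n _ _ → Rows.S≤S′ i i+1≤n j
  ; magog     = λ i j 1≤i i≤n-2 1≤j _ → Rows.S+gap≤S′ i (<⇒≤ (≤∸2⇒2+≤ 1≤i i≤n-2)) j 1≤j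
  }
  where
  module Row (i : ℕ) (i≤n : i ≤ n) = GapRowSums (proj₁ (holes-bounds H i i≤n)) (proj₂ (holes-bounds H i i≤n))
  module Rows (i : ℕ) (i+1≤n : suc i ≤ n) = ConsecutiveGapRows
    (proj₁ (holes-bounds H i (<⇒≤ i+1≤n))) (proj₂ (holes-bounds H i (<⇒≤ i+1≤n)))
    (proj₁ (holes-bounds H (suc i) i+1≤n)) (proj₂ (holes-bounds H (suc i) i+1≤n))
    (holes-increasing H i i+1≤n)

  rowTotal : ∀ i → i ≤ n → blockSum (staircase n x) i n ≡ i
  rowTotal i i≤n with m≤n⇒m<n∨m≡n i≤n
  ... | inj₁ i<n  = suc-injective (Row.S-beyond i i≤n n i<n)
  ... | inj₂ refl = Row.S-below n ≤-refl n (≤-reflexive (sym (holes-last n x)))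

-- Recovering the hole sequence from the column sums

HasHole-psum : ∀ {n m f y} → HasHole n m f y → ∀ j → j ≤ n → psum j f ≡ psum j (gapRow m y)
HasHole-psum (_ , _ , agree) j j≤n = psum-cong j (All[1,]-weaken j≤n agree)

lastZero : (ℕ → ℕ) → ℕ → ℕ
lastZero f zero    = 0
lastZero f (suc m) with f (suc m) ≟ 0
... | yes _ = suc m
... | no _  = lastZero f m

lastZero-cong : ∀ m {f g} → f ≗[ m ] g → lastZero f m ≡ lastZero g m
lastZero-cong zero    f≗g = refl
lastZero-cong (suc m) {f} {g} f≗g with f (suc m) ≟ 0 | g (suc m) ≟ 0
... | yes _   | yes _   = refl
... | no _    | no _    = lastZero-cong m (All[1,]-init f≗g)
... | yes f≡0 | no g≢0  = ⊥-elim (g≢0 (trans (sym (All[1,]-last f≗g)) f≡0))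
... | no f≢0  | yes g≡0 = ⊥-elim (f≢0 (trans (All[1,]-last f≗g) g≡0))

lastZero-gapRow : ∀ m {y} → 1 ≤ y → y ≤ m → lastZero (gapRow m y) m ≡ y
lastZero-gapRow zero    1≤y y≤0 = ⊥-elim (<⇒≱ 1≤y y≤0)
lastZero-gapRow (suc m) {y} 1≤y y≤m+1 with gapRow (suc m) y (suc m) ≟ 0 | m≤n⇒m<n∨m≡n y≤m+1
... | yes _    | inj₂ refl      = refl
... | no ≢0    | inj₂ refl      = ⊥-elim (≢0 (gapRow-hole (suc m) (suc m)))
... | yes ≡0   | inj₁ (s≤s y≤m) =
  ⊥-elim (1+n≢0 (trans (sym (gapRow-in ≤-refl (λ e → <⇒≢ (s≤s y≤m) (sym e)))) ≡0))
... | no _     | inj₁ (s≤s y≤m) = begin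
  lastZero (gapRow (suc m) y) m  ≡⟨ lastZero-cong m (λ k _ k≤m → sym (gapRow-extend k≤m (n≤1+n m))) ⟩
  lastZero (gapRow m y) m        ≡⟨ lastZero-gapRow m 1≤y y≤m ⟩
  y                              ∎
  where open ≡-Reasoning

module ColumnSumsToHoles {n c} (M : IsMagogColumnSums n c) (row0 : All[1, n ] (λ j → c 0 j ≡ 0))
                         (corner : c 1 1 ≡ 1 ⊎ c 1 2 ≡ 1) where
  open IsMagogColumnSums M

  row0-psum : ∀ j → j ≤ n → blockSum c 0 j ≡ 0
  row0-psum zero    _      = refl
  row0-psum (suc j) j+1≤n = cong₂ _+_ (row0-psum j (<⇒≤ j+1≤n)) (row0 (suc j) (s≤s z≤n) j+1≤n)

  rowTotal : ∀ i → i ≤ n → blockSum c i n ≡ i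
  rowTotal zero    _      = row0-psum n ≤-refl
  rowTotal (suc i) i+1≤n = trans (rowSum i i+1≤n) (cong suc (rowTotal i (<⇒≤ i+1≤n)))

  row≤1 : ∀ i → 1 ≤ i → i ≤ n → All[1, n ] (λ j → c i j ≤ 1)
  row≤1 i 1≤i i≤n j 1≤j j≤n = entry≤1 i j 1≤i i≤n 1≤j j≤n

  firstHole : 2 ≤ n → ∃[ y ] HasHole n 2 (c 1) y
  firstHole 2≤n = psum-pred∧stable⇒hole 2 n 2≤n (row≤1 1 ≤-refl 1≤n)
                    (cong suc p₁₂≡1) (trans (rowTotal 1 1≤n) (sym p₁₂≡1))
    where
    1≤n : 1 ≤ n
    1≤n = ≤-trans (n≤1+n 1) 2≤n
    corner⇒1≤p₁₂ : c 1 1 ≡ 1 ⊎ c 1 2 ≡ 1 → 1 ≤ blockSum c 1 2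
    corner⇒1≤p₁₂ (inj₁ c₁₁≡1) = ≤-trans (≤-reflexive (sym c₁₁≡1)) (m≤m+n (c 1 1) (c 1 2))
    corner⇒1≤p₁₂ (inj₂ c₁₂≡1) = ≤-trans (≤-reflexive (sym c₁₂≡1)) (m≤n+m (c 1 2) _)
    p₁₂≡1 : blockSum c 1 2 ≡ 1
    p₁₂≡1 = ≤-antisym (≤-trans (psum-mono (c 1) 2≤n) (≤-reflexive (rowTotal 1 1≤n))) (corner⇒1≤p₁₂ corner)

  module _ {i y} (1≤i : 1 ≤ i) (i+2≤n : 2 + i ≤ n) (hole : HasHole n (suc i) (c i) y) where
    private
      i+1≤n : suc i ≤ n
      i+1≤n = <⇒≤ i+2≤n
      i≤n : i ≤ n
      i≤n = <⇒≤ i+1≤n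
      i≤n-2 : i ≤ n ∸ 2
      i≤n-2 = 2+≤⇒≤∸2 i+2≤n
      1≤y = proj₁ hole
      y≤i+1 = proj₁ (proj₂ hole)
      c≡gap = proj₂ (proj₂ hole)
    open GapRowSums 1≤y y≤i+1

    -- Row i+1 has i+1 ones; the magog inequality at the last one of row i shows that they all lie in [1, i+2].
    nextRow-prefix : blockSum c (suc i) (2 + i) ≡ suc i
    nextRow-prefix = ≤-antisym (≤-trans (psum-mono (c (suc i)) i+2≤n) (≤-reflexive (rowTotal (suc i) i+1≤n))) lower
      where
      lower : suc i ≤ blockSum c (suc i) (2 + i)
      lower with m≤n⇒m<n∨m≡n i+2≤n | y ≤? i
      ... | inj₂ i+2≡n | _ = ≤-reflexive (sym (trans (cong (blockSum c (suc i)) i+2≡n) (rowTotal (suc i) i+1≤n)))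
      ... | inj₁ i+3≤n | yes y≤i = begin
        suc i                               ≡⟨ +-comm 1 i ⟩
        i + 1                               ≡⟨ cong₂ _+_ p≡i c≡1 ⟨
        blockSum c i (suc i) + c i (suc i)  ≤⟨ magog i (suc i) 1≤i i≤n-2 (s≤s z≤n) (2+≤⇒≤∸2 i+3≤n) ⟩
        blockSum c (suc i) (2 + i)          ∎
        where
        open ≤-Reasoning
        p≡i : blockSum c i (suc i) ≡ i
        p≡i = trans (HasHole-psum hole (suc i) i+1≤n) (suc-injective (S-beyond (suc i) ≤-refl))
        c≡1 : c i (suc i) ≡ 1
        c≡1 = trans (c≡gap (suc i) (s≤s z≤n) i+1≤n) (gapRow-in ≤-refl (λ e → 1+n≰n (≤-trans (≤-reflexive e) y≤i)))
      ... | inj₁ _ | no y≰i = begin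
        suc i                               ≡⟨ +-comm 1 i ⟩
        i + 1                               ≡⟨ cong₂ _+_ p≡i c≡1 ⟨
        blockSum c i i + c i i              ≤⟨ magog i i 1≤i i≤n-2 1≤i i≤n-2 ⟩
        blockSum c (suc i) (suc i)          ≤⟨ psum-mono (c (suc i)) (n≤1+n _) ⟩
        blockSum c (suc i) (2 + i)          ∎
        where
        open ≤-Reasoning
        y≡i+1 : y ≡ suc i
        y≡i+1 = ≤-antisym y≤i+1 (≰⇒> y≰i)
        p≡i : blockSum c i i ≡ i
        p≡i = trans (HasHole-psum hole i i≤n) (S-below i (≤-reflexive (sym y≡i+1)))
        c≡1 : c i i ≡ 1
        c≡1 = trans (c≡gap i 1≤i i≤n) (gapRow-in (n≤1+n i) (λ e → <⇒≢ (n<1+n i) (trans e y≡i+1)))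

    nextHole : ∃[ y′ ] HasHole n (2 + i) (c (suc i)) y′
    nextHole = psum-pred∧stable⇒hole (2 + i) n i+2≤n (row≤1 (suc i) (s≤s z≤n) i+1≤n) (cong suc nextRow-prefix)
                 (trans (rowTotal (suc i) i+1≤n) (sym nextRow-prefix))

    -- A hole y′ ≤ y would contradict the magog inequality at column y−1, the last one of row i before its hole.
    nextHole-increasing : ∀ {y′} → HasHole n (2 + i) (c (suc i)) y′ → 2 ≤ y → y < y′
    nextHole-increasing {y′} hole′@(1≤y′ , y′≤i+2 , _) 2≤y with y′ ≤? y
    ... | no y′≰y  = ≰⇒> y′≰y
    ... | yes y′≤y = ⊥-elim (<-irrefl refl (begin-strict
      y                                  ≡⟨ suc-pred y ⟨
      suc k                              ≡⟨ +-comm 1 k ⟩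
      k + 1                              ≡⟨ cong₂ _+_ p≡k c≡1 ⟨
      blockSum c i k + c i k             ≤⟨ magog i k 1≤i i≤n-2 1≤k (≤-trans k≤i i≤n-2) ⟩
      blockSum c (suc i) (suc k)         ≡⟨ cong (blockSum c (suc i)) (suc-pred y) ⟩
      blockSum c (suc i) y               ≡⟨ HasHole-psum hole′ y y≤n ⟩
      psum y (gapRow (2 + i) y′)         <⟨ S′<from y y′≤y ⟩
      y                                  ∎))
      where
      open ≤-Reasoning
      open GapRowSums 1≤y′ y′≤i+2 renaming (S<from to S′<from) using ()
      instance
        y≢0 : NonZero y
        y≢0 = >-nonZero (≤-trans (s≤s z≤n) 2≤y)
      k = pred y
      1≤k : 1 ≤ k
      1≤k = ≤-pred (≤-trans 2≤y (≤-reflexive (sym (suc-pred y))))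
      k≤i : k ≤ i
      k≤i = ≤-pred (≤-trans (≤-reflexive (suc-pred y)) y≤i+1)
      y≤n : y ≤ n
      y≤n = ≤-trans y≤i+1 i+1≤n
      p≡k : blockSum c i k ≡ k
      p≡k = trans (HasHole-psum hole k (≤-trans k≤i i≤n)) (S-below k (≤-reflexive (suc-pred y)))
      c≡1 : c i k ≡ 1
      c≡1 = trans (c≡gap k 1≤k (≤-trans k≤i i≤n)) (gapRow-in (m≤n⇒m≤1+n k≤i) (<⇒≢ (≤-reflexive (suc-pred y))))

  holeOf : ∀ i → 1 ≤ i → i < n → ∃[ y ] HasHole n (suc i) (c i) y
  holeOf (suc zero)    _ 2≤n   = firstHole 2≤n
  holeOf (suc (suc i)) _ i+3≤n =
    nextHole (s≤s z≤n) i+3≤n (proj₂ (holeOf (suc i) (s≤s z≤n) (<⇒≤ i+3≤n)))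

  x : ℕ → ℕ
  x i = lastZero (c i) (suc i)

  x≡hole : ∀ {i y} → i < n → HasHole n (suc i) (c i) y → x i ≡ y
  x≡hole {i} {y} i<n (1≤y , y≤i+1 , c≡gap) =
    trans (lastZero-cong (suc i) (All[1,]-weaken i<n c≡gap)) (lastZero-gapRow (suc i) 1≤y y≤i+1)

  x-holeSequence : IsHoleSequence n x
  x-holeSequence = record
    { hole≥1 = λ i 1≤i i<n → let y , hole = holeOf i 1≤i i<n in
        subst (1 ≤_) (sym (x≡hole i<n hole)) (proj₁ hole)
    ; hole≤  = λ i 1≤i i<n → let y , hole = holeOf i 1≤i i<n in
        subst (_≤ suc i) (sym (x≡hole i<n hole)) (proj₁ (proj₂ hole))
    ; hole-< = λ i 1≤i i+2≤n 2≤x → let y , hole = holeOf i 1≤i (<⇒≤ i+2≤n)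
                                       y′ , hole′ = nextHole 1≤i i+2≤n hole
                                       x≡y = x≡hole (<⇒≤ i+2≤n) hole in
        subst₂ _<_ (sym x≡y) (sym (x≡hole i+2≤n hole′))
               (nextHole-increasing 1≤i i+2≤n hole hole′ (subst (2 ≤_) x≡y 2≤x))
    }

  c≡staircase : ∀ i → i ≤ n → All[1, n ] (λ j → c i j ≡ staircase n x i j)
  c≡staircase zero _ j 1≤j j≤n = trans (row0 j 1≤j j≤n) (sym (staircase-first n x 1≤j))
  c≡staircase (suc i) i+1≤n j 1≤j j≤n with m≤n⇒m<n∨m≡n i+1≤n
  ... | inj₂ refl = trans (lastRow j 1≤j j≤n) (sym (staircase-last (suc i) x j≤n))
  ... | inj₁ i+1<n = let y , hole = holeOf (suc i) (s≤s z≤n) i+1<n in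
    trans (proj₂ (proj₂ hole) j 1≤j j≤n)
          (cong (λ h → gapRow (suc (suc i)) h j) (sym (trans (holes-inner n x i i+1<n) (x≡hole i+1<n hole))))

-- Counting hole sequences

opaque
  appendTop : ℕ → (ℕ → ℕ) → ℕ → ℕ
  appendTop m f i with i ≤? m
  ... | yes _ = f i
  ... | no _  = suc (suc m)

  appendTop-≤ : ∀ m f {i} → i ≤ m → appendTop m f i ≡ f i
  appendTop-≤ m f {i} i≤m with i ≤? m
  ... | yes _   = refl
  ... | no i≰m  = ⊥-elim (i≰m i≤m)

  appendTop-last : ∀ m f → appendTop m f (suc m) ≡ suc (suc m)
  appendTop-last m f with suc m ≤? m
  ... | yes m+1≤m = ⊥-elim (1+n≰n m+1≤m)
  ... | no _      = refl

prependOne : (ℕ → ℕ) → ℕ → ℕ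
prependOne f zero          = 1
prependOne f (suc zero)    = 1
prependOne f (suc (suc k)) = f (suc k)

holeSequences : ℕ → List (ℕ → ℕ)
holeSequences zero    = (λ _ → 1) ∷ []
holeSequences (suc m) = map (appendTop m) (holeSequences m) ++ map prependOne (holeSequences m)

length-holeSequences : ∀ m → length (holeSequences m) ≡ 2 ^ m
length-holeSequences zero    = refl
length-holeSequences (suc m) = begin
  length (map (appendTop m) xs ++ map prependOne xs)        ≡⟨ length-++ (map (appendTop m) xs) ⟩
  length (map (appendTop m) xs) + length (map prependOne xs) ≡⟨ cong₂ _+_ (length-map _ xs) (length-map _ xs) ⟩
  length xs + length xs                                      ≡⟨ cong (λ l → l + l) (length-holeSequences m) ⟩
  2 ^ m + 2 ^ m                                              ≡⟨ cong (_+_ (2 ^ m)) (+-identityʳ (2 ^ m)) ⟨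
  2 ^ suc m                                                  ∎
  where
  open ≡-Reasoning
  xs = holeSequences m

appendTop-holeSequence : ∀ m f → IsHoleSequence (suc m) f → IsHoleSequence (suc (suc m)) (appendTop m f)
appendTop-holeSequence m f H = record { hole≥1 = ≥1 ; hole≤ = ≤top ; hole-< = increasing }
  where
  open IsHoleSequence H
  ≥1 : ∀ i → 1 ≤ i → i < suc (suc m) → 1 ≤ appendTop m f i
  ≥1 i 1≤i (s≤s i≤m+1) with m≤n⇒m<n∨m≡n i≤m+1
  ... | inj₁ (s≤s i≤m) = subst (1 ≤_) (sym (appendTop-≤ m f i≤m)) (hole≥1 i 1≤i (s≤s i≤m))
  ... | inj₂ refl      = subst (1 ≤_) (sym (appendTop-last m f)) (s≤s z≤n)
  ≤top : ∀ i → 1 ≤ i → i < suc (suc m) → appendTop m f i ≤ suc i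
  ≤top i 1≤i (s≤s i≤m+1) with m≤n⇒m<n∨m≡n i≤m+1
  ... | inj₁ (s≤s i≤m) = subst (_≤ suc i) (sym (appendTop-≤ m f i≤m)) (hole≤ i 1≤i (s≤s i≤m))
  ... | inj₂ refl      = ≤-reflexive (appendTop-last m f)
  increasing : ∀ i → 1 ≤ i → suc i < suc (suc m) → 2 ≤ appendTop m f i → appendTop m f i < appendTop m f (suc i)
  increasing i 1≤i (s≤s i+1≤m+1) 2≤x with m≤n⇒m<n∨m≡n i+1≤m+1
  ... | inj₁ (s≤s i+1≤m) rewrite appendTop-≤ m f (<⇒≤ i+1≤m) | appendTop-≤ m f i+1≤m =
    hole-< i 1≤i (s≤s i+1≤m) 2≤x
  ... | inj₂ refl rewrite appendTop-≤ m f (≤-refl {i}) | appendTop-last m f = s≤s (hole≤ i 1≤i ≤-refl)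

prependOne-holeSequence : ∀ m f → IsHoleSequence (suc m) f → IsHoleSequence (suc (suc m)) (prependOne f)
prependOne-holeSequence m f H = record { hole≥1 = ≥1 ; hole≤ = ≤top ; hole-< = increasing }
  where
  open IsHoleSequence H
  ≥1 : ∀ i → 1 ≤ i → i < suc (suc m) → 1 ≤ prependOne f i
  ≥1 (suc zero)    _ _             = ≤-refl
  ≥1 (suc (suc k)) _ (s≤s k+2≤m+1) = hole≥1 (suc k) (s≤s z≤n) k+2≤m+1
  ≤top : ∀ i → 1 ≤ i → i < suc (suc m) → prependOne f i ≤ suc i
  ≤top (suc zero)    _ _             = s≤s z≤n
  ≤top (suc (suc k)) _ (s≤s k+2≤m+1) = m≤n⇒m≤1+n (hole≤ (suc k) (s≤s z≤n) k+2≤m+1)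
  increasing : ∀ i → 1 ≤ i → suc i < suc (suc m) → 2 ≤ prependOne f i → prependOne f i < prependOne f (suc i)
  increasing (suc zero)    _ _             (s≤s ())
  increasing (suc (suc k)) _ (s≤s k+3≤m+1) 2≤x = hole-< (suc k) (s≤s z≤n) k+3≤m+1 2≤x

holeSequences-holeSequence : ∀ m → All (IsHoleSequence (suc m)) (holeSequences m)
holeSequences-holeSequence zero    = empty ∷ []
  where
  empty : IsHoleSequence 1 (λ _ → 1)
  empty = record { hole≥1 = λ _ _ _ → ≤-refl ; hole≤ = λ _ _ _ → s≤s z≤n
                 ; hole-< = λ { _ 1≤i (s≤s i+1≤0) → ⊥-elim (<⇒≱ 1≤i (<⇒≤ i+1≤0)) } }
holeSequences-holeSequence (suc m) = All.++⁺
  (All.map⁺ (All.map (appendTop-holeSequence m _) (holeSequences-holeSequence m)))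
  (All.map⁺ (All.map (prependOne-holeSequence m _) (holeSequences-holeSequence m)))

IsHoleSequence-init : ∀ {n x} → IsHoleSequence (suc n) x → IsHoleSequence n x
IsHoleSequence-init H = record
  { hole≥1 = λ i 1≤i i<n → hole≥1 i 1≤i (m≤n⇒m≤1+n i<n)
  ; hole≤  = λ i 1≤i i<n → hole≤ i 1≤i (m≤n⇒m≤1+n i<n)
  ; hole-< = λ i 1≤i i+1<n → hole-< i 1≤i (m≤n⇒m≤1+n i+1<n)
  }
  where open IsHoleSequence H

hole-growth : ∀ {n x} → IsHoleSequence n x → ∀ {i} → 1 ≤ i → 2 ≤ x i → ∀ d → i + d < n → x i + d ≤ x (i + d)
hole-growth {n} {x} H {i} 1≤i 2≤x zero    _       = ≤-reflexive (trans (+-identityʳ _) (cong x (sym (+-identityʳ i))))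
hole-growth {n} {x} H {i} 1≤i 2≤x (suc d) i+d+1<n = begin
  x i + suc d      ≡⟨ +-suc (x i) d ⟩
  suc (x i + d)    ≤⟨ s≤s ih ⟩
  suc (x (i + d))  ≤⟨ IsHoleSequence.hole-< H (i + d) (≤-trans 1≤i (m≤m+n i d)) i+d+1<n′
                       (≤-trans 2≤x (≤-trans (m≤m+n _ d) ih)) ⟩
  x (suc (i + d))  ≡⟨ cong x (+-suc i d) ⟨
  x (i + suc d)    ∎
  where
  open ≤-Reasoning
  i+d+1<n′ : suc (i + d) < n
  i+d+1<n′ = subst (_< n) (+-suc i d) i+d+1<n
  ih : x i + d ≤ x (i + d)
  ih = hole-growth H 1≤i 2≤x d (≤-trans (s≤s (+-monoʳ-≤ i (n≤1+n d))) i+d+1<n)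

below-top⇒hole≤ : ∀ {m x} → IsHoleSequence (suc (suc m)) x → x (suc m) ≤ suc m →
                  ∀ {i} → 1 ≤ i → i ≤ suc m → 2 ≤ x i → x i ≤ i
below-top⇒hole≤ {m} {x} H last≤ {i} 1≤i i≤m+1 2≤x = +-cancelʳ-≤ d (x i) i (begin
  x i + d          ≤⟨ hole-growth H 1≤i 2≤x d (s≤s (≤-reflexive i+d≡m+1)) ⟩
  x (i + d)        ≡⟨ cong x i+d≡m+1 ⟩
  x (suc m)        ≤⟨ last≤ ⟩
  suc m            ≡⟨ i+d≡m+1 ⟨
  i + d            ∎)
  where
  open ≤-Reasoning
  d = suc m ∸ i
  i+d≡m+1 : i + d ≡ suc m
  i+d≡m+1 = m+[n∸m]≡n i≤m+1

tail-holeSequence : ∀ {m x} → IsHoleSequence (suc (suc m)) x → x (suc m) ≤ suc m →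
                    IsHoleSequence (suc m) (λ i → x (suc i))
tail-holeSequence {m} {x} H last≤ = record
  { hole≥1 = λ i _ i<m+1 → hole≥1 (suc i) (s≤s z≤n) (s≤s i<m+1)
  ; hole≤  = ≤top
  ; hole-< = λ i _ i+1<m+1 → hole-< (suc i) (s≤s z≤n) (s≤s i+1<m+1)
  }
  where
  open IsHoleSequence H
  ≤top : ∀ i → 1 ≤ i → i < suc m → x (suc i) ≤ suc i
  ≤top i _ (s≤s i≤m) with 2 ≤? x (suc i)
  ... | yes 2≤x = below-top⇒hole≤ H last≤ (s≤s z≤n) (s≤s i≤m) 2≤x
  ... | no 2≰x  = ≤-trans (≤-pred (≰⇒> 2≰x)) (s≤s z≤n)

holeSequences-complete : ∀ m {x} → IsHoleSequence (suc m) x → ∃[ f ] f ∈ holeSequences m × f ≗[ m ] x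
holeSequences-complete zero    H = _ , here refl , λ i 1≤i i≤0 → ⊥-elim (<⇒≱ 1≤i i≤0)
holeSequences-complete (suc m) {x} H with x (suc m) ≟ suc (suc m)
... | yes last≡top =
  let f , f∈ , f≗x = holeSequences-complete m (IsHoleSequence-init H) in
  appendTop m f , ∈-++⁺ˡ (∈-map⁺ (appendTop m) f∈) , agree f f≗x
  where
  agree : ∀ f → f ≗[ m ] x → appendTop m f ≗[ suc m ] x
  agree f f≗x i 1≤i i≤m+1 with m≤n⇒m<n∨m≡n i≤m+1
  ... | inj₁ (s≤s i≤m) = trans (appendTop-≤ m f i≤m) (f≗x i 1≤i i≤m)
  ... | inj₂ refl      = trans (appendTop-last m f) (sym last≡top)
... | no last≢top =
  let f , f∈ , f≗tail = holeSequences-complete m (tail-holeSequence H last≤) in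
  prependOne f , ∈-++⁺ʳ (map (appendTop m) (holeSequences m)) (∈-map⁺ prependOne f∈) , agree f f≗tail
  where
  open IsHoleSequence H
  last≤ : x (suc m) ≤ suc m
  last≤ = ≤-pred (≤∧≢⇒< (hole≤ (suc m) (s≤s z≤n) ≤-refl) last≢top)
  x₁≡1 : x 1 ≡ 1
  x₁≡1 with 2 ≤? x 1
  ... | yes 2≤x = ⊥-elim (<⇒≱ 2≤x (below-top⇒hole≤ H last≤ ≤-refl (s≤s z≤n) 2≤x))
  ... | no 2≰x  = ≤-antisym (≤-pred (≰⇒> 2≰x)) (hole≥1 1 ≤-refl (s≤s (s≤s z≤n)))
  agree : ∀ f → f ≗[ m ] (λ i → x (suc i)) → prependOne f ≗[ suc m ] x
  agree f f≗tail (suc zero)    _ _            = sym x₁≡1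
  agree f f≗tail (suc (suc k)) _ (s≤s k+1≤m) = f≗tail (suc k) (s≤s z≤n) k+1≤m

prependOne-last≤ : ∀ m {g} → IsHoleSequence (suc m) g → prependOne g (suc m) ≤ suc m
prependOne-last≤ zero    _ = ≤-refl
prependOne-last≤ (suc k) H = IsHoleSequence.hole≤ H (suc k) (s≤s z≤n) ≤-refl

holeSequences-distinct : ∀ m → AllPairs (λ f g → ¬ f ≗[ m ] g) (holeSequences m)
holeSequences-distinct zero    = [] ∷ []
holeSequences-distinct (suc m) = AllPairs.++⁺
  (AllPairs.map⁺ (AllPairs.map appendTop-injective (holeSequences-distinct m)))
  (AllPairs.map⁺ (AllPairs.map prependOne-injective (holeSequences-distinct m)))
  (All.tabulate λ f∈ → All.tabulate λ g∈ → top≢prependOne f∈ g∈)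
  where
  appendTop-injective : ∀ {f g} → ¬ f ≗[ m ] g → ¬ appendTop m f ≗[ suc m ] appendTop m g
  appendTop-injective {f} {g} f≉g eq = f≉g λ i 1≤i i≤m →
    trans (sym (appendTop-≤ m f i≤m)) (trans (eq i 1≤i (m≤n⇒m≤1+n i≤m)) (appendTop-≤ m g i≤m))
  prependOne-injective : ∀ {f g} → ¬ f ≗[ m ] g → ¬ prependOne f ≗[ suc m ] prependOne g
  prependOne-injective f≉g eq = f≉g λ { (suc i) _ i+1≤m → eq (suc (suc i)) (s≤s z≤n) (s≤s i+1≤m) }
  top≢prependOne : ∀ {a b} → a ∈ map (appendTop m) (holeSequences m) → b ∈ map prependOne (holeSequences m) →
                   ¬ a ≗[ suc m ] b
  top≢prependOne a∈ b∈ eq with ∈-map⁻ (appendTop m) a∈ | ∈-map⁻ prependOne b∈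
  ... | f , _ , refl | g , g∈ , refl = 1+n≰n (begin
    suc (suc m)               ≡⟨ appendTop-last m f ⟨
    appendTop m f (suc m)     ≡⟨ eq (suc m) (s≤s z≤n) ≤-refl ⟩
    prependOne g (suc m)      ≤⟨ prependOne-last≤ m (All.lookup (holeSequences-holeSequence m) g∈) ⟩
    suc m                     ∎)
    where open ≤-Reasoning

-- Matrices

All-range1⁺ : ∀ {P : ℕ → Set} n → All[1, n ] P → All P (range1 n)
All-range1⁺ zero    h = []
All-range1⁺ (suc n) h = All.++⁺ (All-range1⁺ n (All[1,]-init h)) (All[1,]-last h ∷ [])

All-range1⁻ : ∀ {P : ℕ → Set} n → All P (range1 n) → All[1, n ] P
All-range1⁻ zero    h k 1≤k k≤0 = ⊥-elim (<⇒≱ 1≤k k≤0)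
All-range1⁻ (suc n) h k 1≤k k≤n+1 with All.++⁻ (range1 n) h | m≤n⇒m<n∨m≡n k≤n+1
... | init , _        | inj₁ (s≤s k≤n) = All-range1⁻ n init k 1≤k k≤n
... | _ , (last ∷ []) | inj₂ refl      = last

vecFrom1 : {A : Set} (k : ℕ) → (ℕ → A) → Vec A k
vecFrom1 zero    f = []
vecFrom1 (suc k) f = f 1 ∷ vecFrom1 k (λ j → f (suc j))

getℤ-vecFrom1 : ∀ k f → All[1, k ] (λ j → getℤ (vecFrom1 k f) j ≡ f j)
getℤ-vecFrom1 (suc k) f (suc zero)    _ _          = refl
getℤ-vecFrom1 (suc k) f (suc (suc j)) _ (s≤s j+1≤k) = getℤ-vecFrom1 k (λ j → f (suc j)) (suc j) (s≤s z≤n) j+1≤k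

getRow-vecFrom1 : ∀ {m} k (f : ℕ → Vec ℤ m) → All[1, k ] (λ i → getRow (vecFrom1 k f) i ≡ f i)
getRow-vecFrom1 (suc k) f (suc zero)    _ _          = refl
getRow-vecFrom1 (suc k) f (suc (suc i)) _ (s≤s i+1≤k) = getRow-vecFrom1 k (λ i → f (suc i)) (suc i) (s≤s z≤n) i+1≤k

getℤ-ext : ∀ {k} (u v : Vec ℤ k) → All[1, k ] (λ j → getℤ u j ≡ getℤ v j) → u ≡ v
getℤ-ext []      []      _   = refl
getℤ-ext (a ∷ u) (b ∷ v) u≗v = cong₂ _∷_ (u≗v 1 ≤-refl (s≤s z≤n))
  (getℤ-ext u v λ { (suc j) _ j+1≤k → u≗v (suc (suc j)) (s≤s z≤n) (s≤s j+1≤k) })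

getRow-ext : ∀ {m k} (u v : Vec (Vec ℤ k) m) → All[1, m ] (λ i → getRow u i ≡ getRow v i) → u ≡ v
getRow-ext []      []      _   = refl
getRow-ext (a ∷ u) (b ∷ v) u≗v = cong₂ _∷_ (u≗v 1 ≤-refl (s≤s z≤n))
  (getRow-ext u v λ { (suc i) _ i+1≤m → u≗v (suc (suc i)) (s≤s z≤n) (s≤s i+1≤m) })

[a+b]-a≡b : ∀ a b → (a ℤ.+ b) ℤ.- a ≡ b
[a+b]-a≡b = solve-∀

[a+b]-b≡a : ∀ a b → (a ℤ.+ b) ℤ.- b ≡ a
[a+b]-b≡a = solve-∀

a+[b-a]≡b : ∀ a b → a ℤ.+ (b ℤ.- a) ≡ b
a+[b-a]≡b = solve-∀

[a-b]+[c-d]≡[a+c]-[b+d] : ∀ a b c d → (a ℤ.- b) ℤ.+ (c ℤ.- d) ≡ (a ℤ.+ c) ℤ.- (b ℤ.+ d)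
[a-b]+[c-d]≡[a+c]-[b+d] = solve-∀

[a-b+c]-d≡[a+c]-[b+d] : ∀ a b c d → ((a ℤ.- b) ℤ.+ c) ℤ.- d ≡ (a ℤ.+ c) ℤ.- (b ℤ.+ d)
[a-b+c]-d≡[a+c]-[b+d] = solve-∀

[a-b]+b≡a : ∀ a b → (a ℤ.- b) ℤ.+ b ≡ a
[a-b]+b≡a = solve-∀

0≤[a]-[b]⇒b≤a : ∀ {a b} → + 0 ℤ.≤ + a ℤ.- + b → b ≤ a
0≤[a]-[b]⇒b≤a 0≤a-b = drop‿+≤+ (0≤i-j⇒j≤i 0≤a-b)

b≤a⇒0≤[a]-[b] : ∀ {a b} → b ≤ a → + 0 ℤ.≤ + a ℤ.- + b
b≤a⇒0≤[a]-[b] b≤a = i≤j⇒0≤j-i (ℤ.+≤+ b≤a)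

ent≡colPartial-diff : ∀ {n} (A : Matrix n) i j → ent A (suc i) j ≡ colPartial A (suc i) j ℤ.- colPartial A i j
ent≡colPartial-diff A i j = sym ([a+b]-a≡b (colPartial A i j) (ent A (suc i) j))

colPartial-injective : ∀ {n} (A B : Matrix n) →
                       (∀ i → i ≤ n → All[1, n ] (λ j → colPartial A i j ≡ colPartial B i j)) → A ≡ B
colPartial-injective {n} A B A≗B = getRow-ext A B λ { (suc i) _ i+1≤n → getℤ-ext _ _ λ j 1≤j j≤n → begin
  ent A (suc i) j                                  ≡⟨ ent≡colPartial-diff A i j ⟩
  colPartial A (suc i) j ℤ.- colPartial A i j      ≡⟨ cong₂ ℤ._-_ (A≗B (suc i) i+1≤n j 1≤j j≤n)
                                                                  (A≗B i (<⇒≤ i+1≤n) j 1≤j j≤n) ⟩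
  colPartial B (suc i) j ℤ.- colPartial B i j      ≡⟨ ent≡colPartial-diff B i j ⟨
  ent B (suc i) j                                  ∎ }
  where open ≡-Reasoning

module ColumnSumsOf {n} (A : Matrix n) (c : ℕ → ℕ → ℕ)
                    (colPartial≡c : ∀ i → i ≤ n → All[1, n ] (λ j → colPartial A i j ≡ + c i j)) where

  ent≡ : ∀ {i j} → suc i ≤ n → 1 ≤ j → j ≤ n → ent A (suc i) j ≡ + c (suc i) j ℤ.- + c i j
  ent≡ {i} {j} i+1≤n 1≤j j≤n = trans (ent≡colPartial-diff A i j)
    (cong₂ ℤ._-_ (colPartial≡c (suc i) i+1≤n j 1≤j j≤n) (colPartial≡c i (<⇒≤ i+1≤n) j 1≤j j≤n))

  rowPartial≡ : ∀ {i} j → suc i ≤ n → j ≤ n → rowPartial A (suc i) j ≡ + blockSum c (suc i) j ℤ.- + blockSum c i j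
  rowPartial≡ zero    _      _      = refl
  rowPartial≡ {i} (suc j) i+1≤n j+1≤n =
    trans (cong₂ ℤ._+_ (rowPartial≡ j i+1≤n (<⇒≤ j+1≤n)) (ent≡ i+1≤n (s≤s z≤n) j+1≤n))
          ([a-b]+[c-d]≡[a+c]-[b+d] (+ blockSum c (suc i) j) (+ blockSum c i j) (+ c (suc i) (suc j)) (+ c i (suc j)))

  magogExpr≡ : ∀ {i j} → suc i ≤ n → 1 ≤ j → suc j ≤ n →
               (rowPartial A (suc i) j ℤ.+ colPartial A (suc i) (suc j)) ℤ.- colPartial A i j ≡
               + blockSum c (suc i) (suc j) ℤ.- + (blockSum c i j + c i j)
  magogExpr≡ {i} {j} i+1≤n 1≤j j+1≤n = begin
    (rowPartial A (suc i) j ℤ.+ colPartial A (suc i) (suc j)) ℤ.- colPartial A i j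
      ≡⟨ cong₂ (λ r q → (r ℤ.+ q) ℤ.- colPartial A i j) (rowPartial≡ j i+1≤n (<⇒≤ j+1≤n))
               (colPartial≡c (suc i) i+1≤n (suc j) (s≤s z≤n) j+1≤n) ⟩
    ((+ blockSum c (suc i) j ℤ.- + blockSum c i j) ℤ.+ + c (suc i) (suc j)) ℤ.- colPartial A i j
      ≡⟨ cong (ℤ._-_ ((+ blockSum c (suc i) j ℤ.- + blockSum c i j) ℤ.+ + c (suc i) (suc j)))
              (colPartial≡c i (<⇒≤ i+1≤n) j 1≤j (<⇒≤ j+1≤n)) ⟩
    ((+ blockSum c (suc i) j ℤ.- + blockSum c i j) ℤ.+ + c (suc i) (suc j)) ℤ.- + c i j
      ≡⟨ [a-b+c]-d≡[a+c]-[b+d] (+ blockSum c (suc i) j) (+ blockSum c i j) (+ c (suc i) (suc j)) (+ c i j) ⟩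
    + blockSum c (suc i) (suc j) ℤ.- + (blockSum c i j + c i j)
      ∎
    where open ≡-Reasoning

  private
    i≤n-2⇒1+i≤n : ∀ {i} → 1 ≤ i → i ≤ n ∸ 2 → suc i ≤ n
    i≤n-2⇒1+i≤n 1≤i i≤n-2 = <⇒≤ (≤∸2⇒2+≤ 1≤i i≤n-2)

  magog⇒columnSums : IsMagog A → IsMagogColumnSums n c
  magog⇒columnSums (rows , cols , colBounds , rowPrefixes , magogs) = record
    { entry≤1   = λ i j 1≤i i≤n 1≤j j≤n → drop‿+≤+ (subst (ℤ._≤ + 1) (colPartial≡c i i≤n j 1≤j j≤n)
                    (proj₂ (All-range1⁻ n (All-range1⁻ n colBounds i 1≤i i≤n) j 1≤j j≤n)))
    ; rowSum    = λ i i+1≤n → +-injective (trans (sym ([a-b]+b≡a (+ blockSum c (suc i) n) (+ blockSum c i n)))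
                    (cong (ℤ._+ + blockSum c i n) (trans (sym (rowPartial≡ n i+1≤n ≤-refl))
                                                        (All-range1⁻ n rows (suc i) (s≤s z≤n) i+1≤n))))
    ; lastRow   = λ j 1≤j j≤n → +-injective (trans (sym (colPartial≡c n ≤-refl j 1≤j j≤n))
                                                   (All-range1⁻ n cols j 1≤j j≤n))
    ; rowPrefix = λ i j i+1≤n 1≤j j≤n → 0≤[a]-[b]⇒b≤a (subst (+ 0 ℤ.≤_) (rowPartial≡ j i+1≤n j≤n)
                    (All-range1⁻ n (All-range1⁻ n rowPrefixes (suc i) (s≤s z≤n) i+1≤n) j 1≤j j≤n))
    ; magog     = λ i j 1≤i i≤n-2 1≤j j≤n-2 → 0≤[a]-[b]⇒b≤a
                    (subst (+ 0 ℤ.≤_) (magogExpr≡ (i≤n-2⇒1+i≤n 1≤i i≤n-2) 1≤j (i≤n-2⇒1+i≤n 1≤j j≤n-2))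
                       (All-range1⁻ (n ∸ 2) (All-range1⁻ (n ∸ 2) magogs i 1≤i i≤n-2) j 1≤j j≤n-2))
    }

  columnSums⇒magog : IsMagogColumnSums n c → IsMagog A
  columnSums⇒magog M = rows , cols , colBounds , rowPrefixes , magogs
    where
    open IsMagogColumnSums M
    rows = All-range1⁺ n λ { (suc i) _ i+1≤n → trans (rowPartial≡ n i+1≤n ≤-refl)
             (trans (cong (λ s → + s ℤ.- + blockSum c i n) (rowSum i i+1≤n)) ([a+b]-b≡a (+ 1) (+ blockSum c i n))) }
    cols = All-range1⁺ n λ j 1≤j j≤n → trans (colPartial≡c n ≤-refl j 1≤j j≤n) (cong +_ (lastRow j 1≤j j≤n))
    colBounds = All-range1⁺ n λ i 1≤i i≤n → All-range1⁺ n λ j 1≤j j≤n →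
      subst (λ z → (+ 0 ℤ.≤ z) × (z ℤ.≤ + 1)) (sym (colPartial≡c i i≤n j 1≤j j≤n))
            (ℤ.+≤+ z≤n , ℤ.+≤+ (entry≤1 i j 1≤i i≤n 1≤j j≤n))
    rowPrefixes = All-range1⁺ n λ { (suc i) _ i+1≤n → All-range1⁺ n λ j 1≤j j≤n →
      subst (+ 0 ℤ.≤_) (sym (rowPartial≡ j i+1≤n j≤n)) (b≤a⇒0≤[a]-[b] (rowPrefix i j i+1≤n 1≤j j≤n)) }
    magogs = All-range1⁺ (n ∸ 2) λ i 1≤i i≤n-2 → All-range1⁺ (n ∸ 2) λ j 1≤j j≤n-2 →
      subst (+ 0 ℤ.≤_) (sym (magogExpr≡ (i≤n-2⇒1+i≤n 1≤i i≤n-2) 1≤j (i≤n-2⇒1+i≤n 1≤j j≤n-2)))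
            (b≤a⇒0≤[a]-[b] (magog i j 1≤i i≤n-2 1≤j j≤n-2))

map-unique : ∀ {A B : Set} {P : A → Set} {R : A → A → Set} (h : A → B) →
             (∀ {a b} → P a → P b → h a ≡ h b → R a b) →
             ∀ {xs} → All P xs → AllPairs (λ a b → ¬ R a b) xs → Unique (map h xs)
map-unique h inj []        []        = []
map-unique h inj (pa ∷ ps) (¬ra ∷ rs) =
  All.map⁺ (All.zipWith (λ (pb , ¬rab) ha≡hb → ¬rab (inj pa pb ha≡hb)) (ps , ¬ra)) ∷ map-unique h inj ps rs

unique-sameMembers⇒length≡ : ∀ {A : Set} {xs ys : List A} → Unique xs → Unique ys →
                             (∀ {a} → a ∈ xs → a ∈ ys) → (∀ {a} → a ∈ ys → a ∈ xs) → length xs ≡ length ys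
unique-sameMembers⇒length≡ uxs uys xs⊆ys ys⊆xs = ↭-length (∼bag⇒↭ (unique∧set⇒bag uxs uys (mk⇔ xs⊆ys ys⊆xs)))

concatMap-map≡cartesianProductWith : ∀ {A B C : Set} (f : A → B → C) xs ys →
                                     concatMap (λ x → map (f x) ys) xs ≡ cartesianProductWith f xs ys
concatMap-map≡cartesianProductWith f []       ys = refl
concatMap-map≡cartesianProductWith f (x ∷ xs) ys = cong (map (f x) ys ++_) (concatMap-map≡cartesianProductWith f xs ys)

allVecs-suc : ∀ {A : Set} (xs : List A) k → allVecs xs (suc k) ≡ cartesianProductWith _∷_ xs (allVecs xs k)
allVecs-suc xs k = concatMap-map≡cartesianProductWith _∷_ xs (allVecs xs k)

allVecs-unique : ∀ {A : Set} {xs : List A} k → Unique xs → Unique (allVecs xs k)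
allVecs-unique zero    _   = [] ∷ []
allVecs-unique {xs = xs} (suc k) uxs rewrite allVecs-suc xs k =
  Unique.cartesianProductWith⁺ _∷_ ∷-injective uxs (allVecs-unique k uxs)

vecFrom1-∈-allVecs : ∀ {A : Set} (xs : List A) k {f} → (∀ j → f j ∈ xs) → vecFrom1 k f ∈ allVecs xs k
vecFrom1-∈-allVecs xs zero    _   = here refl
vecFrom1-∈-allVecs xs (suc k) f∈ rewrite allVecs-suc xs k =
  ∈-cartesianProductWith⁺ _∷_ (f∈ 1) (vecFrom1-∈-allVecs xs k (λ j → f∈ (suc j)))

entryValues-unique : Unique entryValues
entryValues-unique = ((λ ()) ∷ (λ ()) ∷ []) ∷ ((λ ()) ∷ []) ∷ [] ∷ []

allMatrices-unique : ∀ n → Unique (allMatrices n)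
allMatrices-unique n = allVecs-unique n (allVecs-unique n entryValues-unique)

[a]-[b]∈entryValues : ∀ {a b} → a ≤ 1 → b ≤ 1 → + a ℤ.- + b ∈ entryValues
[a]-[b]∈entryValues {a} {b} a≤1 b≤1 with n≤1⇒n≡0∨n≡1 a≤1 | n≤1⇒n≡0∨n≡1 b≤1
... | inj₁ refl | inj₁ refl = here refl
... | inj₁ refl | inj₂ refl = there (there (here refl))
... | inj₂ refl | inj₁ refl = there (here refl)
... | inj₂ refl | inj₂ refl = here refl

fromColumnSums : (n : ℕ) → (ℕ → ℕ → ℕ) → Matrix n
fromColumnSums n c = vecFrom1 n (λ i → vecFrom1 n (λ j → + c i j ℤ.- + c (pred i) j))

fromColumnSums-∈ : ∀ n {c} → (∀ i j → c i j ≤ 1) → fromColumnSums n c ∈ allMatrices n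
fromColumnSums-∈ n c≤1 = vecFrom1-∈-allVecs _ n λ i → vecFrom1-∈-allVecs _ n λ j →
  [a]-[b]∈entryValues (c≤1 i j) (c≤1 (pred i) j)

colPartial-fromColumnSums : ∀ n c → All[1, n ] (λ j → c 0 j ≡ 0) →
                            ∀ i → i ≤ n → All[1, n ] (λ j → colPartial (fromColumnSums n c) i j ≡ + c i j)
colPartial-fromColumnSums n c row0 zero    _     j 1≤j j≤n = cong +_ (sym (row0 j 1≤j j≤n))
colPartial-fromColumnSums n c row0 (suc i) i+1≤n j 1≤j j≤n = begin
  colPartial B i j ℤ.+ ent B (suc i) j
    ≡⟨ cong₂ ℤ._+_ (colPartial-fromColumnSums n c row0 i (<⇒≤ i+1≤n) j 1≤j j≤n) ent≡ ⟩
  + c i j ℤ.+ (+ c (suc i) j ℤ.- + c i j)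
    ≡⟨ a+[b-a]≡b (+ c i j) (+ c (suc i) j) ⟩
  + c (suc i) j
    ∎
  where
  open ≡-Reasoning
  B = fromColumnSums n c
  ent≡ : ent B (suc i) j ≡ + c (suc i) j ℤ.- + c i j
  ent≡ = trans (cong (λ r → getℤ r j) (getRow-vecFrom1 n _ (suc i) (s≤s z≤n) i+1≤n))
               (getℤ-vecFrom1 n _ j 1≤j j≤n)

holes-cong : ∀ m {f g} → f ≗[ m ] g → ∀ i → holes (suc m) f i ≡ holes (suc m) g i
holes-cong m {f} {g} f≗g zero    = trans (holes-0 _ f) (sym (holes-0 _ g))
holes-cong m {f} {g} f≗g (suc i) with suc m ≤? suc i
... | yes m+1≤i+1 = trans (holes-outer _ f i m+1≤i+1) (sym (holes-outer _ g i m+1≤i+1))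
... | no m+1≰i+1  = begin
  holes (suc m) f (suc i)  ≡⟨ holes-inner _ f i (≰⇒> m+1≰i+1) ⟩
  f (suc i)                ≡⟨ f≗g (suc i) (s≤s z≤n) (≤-pred (≰⇒> m+1≰i+1)) ⟩
  g (suc i)                ≡⟨ holes-inner _ g i (≰⇒> m+1≰i+1) ⟨
  holes (suc m) g (suc i)  ∎
  where open ≡-Reasoning

lastZero-staircase : ∀ {n x} → IsHoleSequence n x → ∀ i → i ≤ n → lastZero (staircase n x i) (suc i) ≡ holes n x i
lastZero-staircase H i i≤n = lastZero-gapRow (suc i) (proj₁ (holes-bounds H i i≤n)) (proj₂ (holes-bounds H i i≤n))

staircase-corner : ∀ {n x} → IsHoleSequence n x → staircase n x 1 1 ≡ 1 ⊎ (2 ≤ n × staircase n x 1 2 ≡ 1)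
staircase-corner {n} {x} H with n ≤? 1
... | yes n≤1 = inj₁ (trans (cong (λ h → gapRow 2 h 1) (holes-outer n x 0 n≤1)) (gapRow-in (s≤s z≤n) (λ ())))
... | no n≰1 with m≤n⇒m<n∨m≡n (proj₂ (holes-bounds H 1 (<⇒≤ (≰⇒> n≰1))))
...   | inj₂ h≡2       = inj₁ (trans (cong (λ h → gapRow 2 h 1) h≡2) (gapRow-in (s≤s z≤n) (λ ())))
...   | inj₁ (s≤s h≤1) = inj₂ (≰⇒> n≰1 , trans (cong (λ h → gapRow 2 h 2) h≡1) (gapRow-in ≤-refl (λ ())))
  where
  h≡1 : holes n x 1 ≡ 1
  h≡1 = ≤-antisym h≤1 (proj₁ (holes-bounds H 1 (<⇒≤ (≰⇒> n≰1))))

magogOf : (n : ℕ) → (ℕ → ℕ) → Matrix n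
magogOf n x = fromColumnSums n (staircase n x)

colPartial-magogOf : ∀ n x i → i ≤ n → All[1, n ] (λ j → colPartial (magogOf n x) i j ≡ + staircase n x i j)
colPartial-magogOf n x = colPartial-fromColumnSums n (staircase n x) (λ j 1≤j _ → staircase-first n x 1≤j)

magogOf-∈ : ∀ n x → magogOf n x ∈ allMatrices n
magogOf-∈ n x = fromColumnSums-∈ n (λ i j → gapRow≤1 _ _ _)

magogOf-magog : ∀ {n x} → IsHoleSequence n x → IsMagog (magogOf n x)
magogOf-magog {n} {x} H =
  ColumnSumsOf.columnSums⇒magog (magogOf n x) (staircase n x) (colPartial-magogOf n x) (staircase-magog H)

magogOf-corner : ∀ {n x} → 1 ≤ n → IsHoleSequence n x → Corner (magogOf n x)
magogOf-corner {n} {x} 1≤n H = corner (staircase-corner H)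
  where
  ent₁≡ : ∀ j → 1 ≤ j → j ≤ n → ent (magogOf n x) 1 j ≡ + staircase n x 1 j
  ent₁≡ j 1≤j j≤n = trans (sym (ℤ.+-identityˡ _)) (colPartial-magogOf n x 1 1≤n j 1≤j j≤n)
  corner : staircase n x 1 1 ≡ 1 ⊎ (2 ≤ n × staircase n x 1 2 ≡ 1) → Corner (magogOf n x)
  corner (inj₁ s₁₁≡1)         = inj₁ (trans (ent₁≡ 1 ≤-refl 1≤n) (cong +_ s₁₁≡1))
  corner (inj₂ (2≤n , s₁₂≡1)) = inj₂ (trans (ent₁≡ 2 (s≤s z≤n) 2≤n) (cong +_ s₁₂≡1))

magogOf-injective : ∀ m {f g} → IsHoleSequence (suc m) f → IsHoleSequence (suc m) g →
                    magogOf (suc m) f ≡ magogOf (suc m) g → f ≗[ m ] g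
magogOf-injective m {f} {g} Hf Hg eq (suc i) _ i+1≤m = begin
  f (suc i)                                 ≡⟨ holes-inner n f i i+1<n ⟨
  holes n f (suc i)                         ≡⟨ lastZero-staircase Hf (suc i) (<⇒≤ i+1<n) ⟨
  lastZero (staircase n f (suc i)) (2 + i)  ≡⟨ lastZero-cong (2 + i) sameRow ⟩
  lastZero (staircase n g (suc i)) (2 + i)  ≡⟨ lastZero-staircase Hg (suc i) (<⇒≤ i+1<n) ⟩
  holes n g (suc i)                         ≡⟨ holes-inner n g i i+1<n ⟩
  g (suc i)                                 ∎
  where
  open ≡-Reasoning
  n = suc m
  i+1<n : suc i < n
  i+1<n = s≤s i+1≤m
  sameRow : staircase n f (suc i) ≗[ 2 + i ] staircase n g (suc i)
  sameRow j 1≤j j≤i+2 = +-injective (begin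
    + staircase n f (suc i) j          ≡⟨ colPartial-magogOf n f (suc i) (<⇒≤ i+1<n) j 1≤j (≤-trans j≤i+2 i+1<n) ⟨
    colPartial (magogOf n f) (suc i) j ≡⟨ cong (λ A → colPartial A (suc i) j) eq ⟩
    colPartial (magogOf n g) (suc i) j ≡⟨ colPartial-magogOf n g (suc i) (<⇒≤ i+1<n) j 1≤j (≤-trans j≤i+2 i+1<n) ⟩
    + staircase n g (suc i) j          ∎)

magog∧corner⇒magogOf : ∀ m (A : Matrix (suc m)) → IsMagog A → Corner A →
                       ∃[ f ] f ∈ holeSequences m × A ≡ magogOf (suc m) f
magog∧corner⇒magogOf m A magog corner =
  let f , f∈ , f≗x = holeSequences-complete m Holes.x-holeSequence in
  f , f∈ , colPartial-injective A (magogOf n f) λ i i≤n j 1≤j j≤n → begin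
    colPartial A i j             ≡⟨ colPartial≡c i i≤n j 1≤j j≤n ⟩
    + c i j                      ≡⟨ cong +_ (Holes.c≡staircase i i≤n j 1≤j j≤n) ⟩
    + staircase n Holes.x i j    ≡⟨ cong (λ h → + gapRow (suc i) h j) (holes-cong m f≗x i) ⟨
    + staircase n f i j          ≡⟨ colPartial-magogOf n f i i≤n j 1≤j j≤n ⟨
    colPartial (magogOf n f) i j ∎
  where
  open ≡-Reasoning
  n = suc m
  -- ∣_∣ loses nothing: the column partial sums of a magog matrix are nonnegative.
  c : ℕ → ℕ → ℕ
  c i j = ∣ colPartial A i j ∣
  colPartial≡c : ∀ i → i ≤ n → All[1, n ] (λ j → colPartial A i j ≡ + c i j)
  colPartial≡c zero    _      _ _   _   = refl
  colPartial≡c (suc i) i+1≤n j 1≤j j≤n =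
    let colBounds = proj₁ (proj₂ (proj₂ magog)) in
    sym (0≤i⇒+∣i∣≡i (proj₁ (All-range1⁻ n (All-range1⁻ n colBounds (suc i) (s≤s z≤n) i+1≤n) j 1≤j j≤n)))
  corner′ : c 1 1 ≡ 1 ⊎ c 1 2 ≡ 1
  corner′ = Sum.map (cong (λ e → ∣ + 0 ℤ.+ e ∣)) (cong (λ e → ∣ + 0 ℤ.+ e ∣)) corner
  module Holes = ColumnSumsToHoles (ColumnSumsOf.magog⇒columnSums A c colPartial≡c magog) (λ _ _ _ → refl) corner′

magogCorner? : ∀ {n} (A : Matrix n) → Dec (IsMagog A × Corner A)
magogCorner? A = isMagog? A ×-dec corner? A

magogCorner⇒∈image : ∀ m {A} → A ∈ filter magogCorner? (allMatrices (suc m)) →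
                     A ∈ map (magogOf (suc m)) (holeSequences m)
magogCorner⇒∈image m {A} A∈ with _ , (magog , corner) ← ∈-filter⁻ magogCorner? {xs = allMatrices (suc m)} A∈
                            with f , f∈ , A≡ ← magog∧corner⇒magogOf m A magog corner =
  subst (_∈ map (magogOf (suc m)) (holeSequences m)) (sym A≡) (∈-map⁺ _ f∈)

∈image⇒magogCorner : ∀ m {A} → A ∈ map (magogOf (suc m)) (holeSequences m) →
                     A ∈ filter magogCorner? (allMatrices (suc m))
∈image⇒magogCorner m A∈ with f , f∈ , refl ← ∈-map⁻ (magogOf (suc m)) A∈ =
  let H = All.lookup (holeSequences-holeSequence m) f∈ in
  ∈-filter⁺ magogCorner? (magogOf-∈ (suc m) f) (magogOf-magog H , magogOf-corner (s≤s z≤n) H)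

lemma3p16 : (n : ℕ) → 1 ≤ n → countMagogCorner n ≡ 2 ^ (n ∸ 1)
lemma3p16 (suc m) _ = begin
  countMagogCorner (suc m)                          ≡⟨ unique-sameMembers⇒length≡ uniqueCorners uniqueImage
                                                         (magogCorner⇒∈image m) (∈image⇒magogCorner m) ⟩
  length (map (magogOf (suc m)) (holeSequences m))  ≡⟨ length-map _ (holeSequences m) ⟩
  length (holeSequences m)                          ≡⟨ length-holeSequences m ⟩
  2 ^ m                                             ∎
  where
  open ≡-Reasoning
  uniqueCorners = Unique.filter⁺ magogCorner? (allMatrices-unique (suc m))
  uniqueImage = map-unique (magogOf (suc m)) (magogOf-injective m)
                  (holeSequences-holeSequence m) (holeSequences-distinct m)
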